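{- Let $t\ge 2$ be an integer and $r=2^t-1$ (so $t=\log_2(r+1)$). There exists an $r$-uniform $r$-partite $2^{t-1}$-regular hypergraph with exactly two vertices in each part that has no $(t-1)$-shallow hitting edge set.
   Context: A hypergraph $H=(V,E)$ has a finite vertex set and a finite multiset of edges (subsets of $V$). $H$ is $r$-uniform if each edge has $r$ vertices; $r$-partite if $V$ can be partitioned into $r$ parts such that every edge meets each part in at most one vertex (a fixed such partition is considered, whose members are the parts); $d$-regular if every vertex lies in exactly $d$ edges. For $M\subseteq E$, $\deg_M(v)$ is the number of edges of $M$ containing $v$; $M$ is hitting if $\deg_M(v)\ge1$ for all $v$ and $s$-shallow if $\deg_M(v)\le s$ for all $v$. -}

module Defs where

open import Data.Nat using (ℕ; _≤_; _∸_; _^_)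
open import Data.Fin using (Fin)
open import Data.Fin.Subset using (Subset; _∈_; ∣_∣)
open import Data.Fin.Subset.Properties using (_∈?_)
open import Data.Fin.Properties using (_≟_)
open import Data.List using (List; length; filter; allFin)
open import Data.List.Membership.Propositional renaming (_∈_ to _∈ₗ_)
open import Data.List.Relation.Binary.Sublist.Propositional using (_⊆_)
open import Data.Product using (Σ; _×_; ∃)
open import Relation.Binary.PropositionalEquality using (_≡_)
open import Relation.Nullary using (¬_)

-- A hypergraph on vertex set Fin n: a finite multiset (list) of edges, each a subset of Fin n.
Edges : ℕ → Set
Edges n = List (Subset n)

deg : {n : ℕ} → Edges n → Fin n → ℕ
deg M v = length (filter (λ e → v ∈? e) M)

Uniform : {n : ℕ} → ℕ → Edges n → Set
Uniform r E = ∀ e → e ∈ₗ E → ∣ e ∣ ≡ r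

-- r-partite w.r.t. a fixed partition into r parts, given by part : Fin n → Fin r
-- (the parts are the fibres; nonemptiness is ensured separately by PartsOfSize).
Partite : {n r : ℕ} → (Fin n → Fin r) → Edges n → Set
Partite part E = ∀ e → e ∈ₗ E → ∀ x y → x ∈ e → y ∈ e → part x ≡ part y → x ≡ y

PartsOfSize : {n r : ℕ} → (Fin n → Fin r) → ℕ → Set
PartsOfSize {n} part k = ∀ i → length (filter (λ x → part x ≟ i) (allFin n)) ≡ k

Regular : {n : ℕ} → ℕ → Edges n → Set
Regular d E = ∀ v → deg E v ≡ d

Hitting : {n : ℕ} → Edges n → Set
Hitting M = ∀ v → 1 ≤ deg M v

Shallow : {n : ℕ} → ℕ → Edges n → Set
Shallow s M = ∀ v → deg M v ≤ s

HasShallowHittingSet : {n : ℕ} → ℕ → Edges n → Set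
HasShallowHittingSet s E = Σ (Edges _) λ M → M ⊆ E × Hitting M × Shallow s M

-- Index the r = 2^t − 1 parts by the nonzero vectors i ∈ F₂^t, part i holding the vertices (i, 0) and
-- (i, 1), and let each x ∈ F₂^t give the edge meeting part i in (i, 1 + i·x). The edges through a vertex
-- are the x on an affine hyperplane i·x = const, so there are 2^(t−1) of them. Given a nonempty
-- multiset of edges x₀, x₁, …, Gaussian elimination yields a nonzero i orthogonal to
-- x₁ − x₀, …, x_{t−1} − x₀ (t − 1 equations in t unknowns), so i·x is constant on x₀, …, x_{t−1}.
-- If these are all the edges, one vertex of part i is never hit; otherwise the other one is hit
-- at least t times.
module Submission where

open import Defs
open import Algebra.Bundles using (CommutativeRing)
open import Data.Bool using (Bool; true; false; not; _∧_; _xor_; if_then_else_)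
open import Data.Bool.Properties
  using (∧-zeroʳ; ∧-distribʳ-xor; xor-assoc; xor-comm; xor-same; xor-inverseˡ; not-distribʳ-xor; xor-∧-commutativeRing)
open import Algebra.Properties.CommutativeSemigroup
  (CommutativeRing.+-commutativeSemigroup xor-∧-commutativeRing) using () renaming (interchange to xor-interchange)
open import Data.Fin using (Fin; zero; suc; splitAt; _↑ˡ_; _↑ʳ_)
open import Data.Fin.Properties using (splitAt-↑ˡ; splitAt-↑ʳ; splitAt⁻¹-↑ˡ; splitAt⁻¹-↑ʳ) renaming (_≟_ to _≟ᶠ_)
open import Data.Fin.Subset using (Subset; inside; outside; ∣_∣; ∁; _∈_)
open import Data.Fin.Subset.Properties using (_∈?_; ∣p∣≤n; ∣∁p∣≡n∸∣p∣)
open import Data.List using (List; []; _∷_; _++_; map; length; filter; allFin; take; drop)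
open import Data.List.Properties using (length-map; length-++; length-take; take-all; take++drop≡id; length-++-sucʳ; map-tabulate)
open import Data.List.Relation.Unary.All using (All; []; _∷_)
import Data.List.Relation.Unary.All as All
open import Data.List.Relation.Unary.All.Properties using (map⁻; ++⁺; ++⁻)
open import Data.List.Membership.Propositional.Properties using (∈-map⁻)
open import Data.List.Relation.Binary.Sublist.Heterogeneous using ([]; _∷_; _∷ʳ_)
open import Data.List.Relation.Binary.Sublist.Propositional using (_⊆_)
open import Data.Nat using (ℕ; zero; suc; _+_; _≤_; _∸_; _^_; _⊓_; s≤s⁻¹)
open import Data.Nat.Properties
  using (+-assoc; +-suc; +-identityʳ; m≤m+n; m⊓n≤m; m≤n⇒m⊓n≡m; m+[n∸m]≡n; ≤-trans; ≤-reflexive; _≤?_; ≰⇒>; <⇒≤; 1+n≰n)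
open import Data.Product using (Σ; ∃; ∃₂; _×_; _,_)
open import Data.Sum using (_⊎_; inj₁; inj₂; [_,_]′)
open import Data.Vec using (Vec; []; _∷_; head; lookup; tabulate; replicate)
import Data.Vec as Vec
open import Data.Vec.Properties using ([]=⇒lookup; lookup-++ˡ; lookup-++ʳ; lookup-map; lookup∘tabulate)
open import Data.Vec.Relation.Unary.Any using (Any; here; there)
open import Function using (_∘_; id; const)
open import Relation.Binary.PropositionalEquality
open import Relation.Nullary using (¬_; does; yes; no; contradiction)
open import Relation.Unary using (Decidable)

count : {A : Set} → (A → Bool) → List A → ℕ
count p []       = 0
count p (x ∷ xs) = (if p x then 1 else 0) + count p xs

module _ {A : Set} where

  count-++ : ∀ (p : A → Bool) xs ys → count p (xs ++ ys) ≡ count p xs + count p ys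
  count-++ p []       ys = refl
  count-++ p (x ∷ xs) ys =
    trans (cong (_ +_) (count-++ p xs ys)) (sym (+-assoc (if p x then 1 else 0) (count p xs) (count p ys)))

  count-map : ∀ {B : Set} (p : B → Bool) (f : A → B) xs → count p (map f xs) ≡ count (p ∘ f) xs
  count-map p f []       = refl
  count-map p f (x ∷ xs) = cong (_ +_) (count-map p f xs)

  count-cong : ∀ {p q : A → Bool} → (∀ x → p x ≡ q x) → ∀ xs → count p xs ≡ count q xs
  count-cong p≗q []       = refl
  count-cong p≗q (x ∷ xs) = cong₂ (λ b n → (if b then 1 else 0) + n) (p≗q x) (count-cong p≗q xs)

  count+count-not≡length : ∀ (p : A → Bool) xs → count p xs + count (not ∘ p) xs ≡ length xs
  count+count-not≡length p []       = refl
  count+count-not≡length p (x ∷ xs) with p x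
  ... | true  = cong suc (count+count-not≡length p xs)
  ... | false = trans (+-suc _ _) (cong suc (count+count-not≡length p xs))

  count-none : ∀ {p : A → Bool} {xs} → All (λ x → p x ≡ false) xs → count p xs ≡ 0
  count-none []        = refl
  count-none (px ∷ ps) rewrite px = count-none ps

  count-all : ∀ {p : A → Bool} {xs} → All (λ x → p x ≡ true) xs → count p xs ≡ length xs
  count-all []        = refl
  count-all (px ∷ ps) rewrite px = cong suc (count-all ps)

  count-take-≤ : ∀ (p : A → Bool) k xs → count p (take k xs) ≤ count p xs
  count-take-≤ p k xs = begin
    count p (take k xs)                         ≤⟨ m≤m+n _ _ ⟩
    count p (take k xs) + count p (drop k xs)   ≡⟨ count-++ p (take k xs) (drop k xs) ⟨
    count p (take k xs ++ drop k xs)            ≡⟨ cong (count p) (take++drop≡id k xs) ⟩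
    count p xs                                  ∎
    where open Data.Nat.Properties.≤-Reasoning

  length-filter≡count : ∀ {P : A → Set} (P? : Decidable P) xs → length (filter P? xs) ≡ count (does ∘ P?) xs
  length-filter≡count P? []       = refl
  length-filter≡count P? (x ∷ xs) with does (P? x)
  ... | true  = cong suc (length-filter≡count P? xs)
  ... | false = length-filter≡count P? xs

  length-map-take-≤ : ∀ {B : Set} (f : A → B) k xs → length (map f (take k xs)) ≤ k
  length-map-take-≤ f k xs =
    ≤-trans (≤-reflexive (trans (length-map f (take k xs)) (length-take k xs))) (m⊓n≤m k (length xs))

  ⊆-map⇒≡map : ∀ {B : Set} (f : A → B) {M} xs → M ⊆ map f xs → ∃ λ L → M ≡ map f L
  ⊆-map⇒≡map f []       []           = [] , refl
  ⊆-map⇒≡map f (x ∷ xs) (_ ∷ʳ M⊆)     = ⊆-map⇒≡map f xs M⊆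
  ⊆-map⇒≡map f (x ∷ xs) (refl ∷ M⊆) with L , refl ← ⊆-map⇒≡map f xs M⊆ = x ∷ L , refl

count-allFin-suc : ∀ n (p : Fin (suc n) → Bool) →
  count p (allFin (suc n)) ≡ (if p zero then 1 else 0) + count (p ∘ suc) (allFin n)
count-allFin-suc n p = cong ((if p zero then 1 else 0) +_)
  (trans (cong (count p) (sym (map-tabulate id suc))) (count-map p suc (allFin n)))

count-allFin-+ : ∀ m n (p : Fin (m + n) → Bool) →
  count p (allFin (m + n)) ≡ count (p ∘ (_↑ˡ n)) (allFin m) + count (p ∘ (m ↑ʳ_)) (allFin n)
count-allFin-+ zero    n p = refl
count-allFin-+ (suc m) n p = begin
  count p (allFin (suc m + n))
    ≡⟨ count-allFin-suc (m + n) p ⟩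
  bit + count (p ∘ suc) (allFin (m + n))
    ≡⟨ cong (bit +_) (count-allFin-+ m n (p ∘ suc)) ⟩
  bit + (count (p ∘ suc ∘ (_↑ˡ n)) (allFin m) + count (p ∘ (suc m ↑ʳ_)) (allFin n))
    ≡⟨ +-assoc bit _ _ ⟨
  bit + count (p ∘ suc ∘ (_↑ˡ n)) (allFin m) + count (p ∘ (suc m ↑ʳ_)) (allFin n)
    ≡⟨ cong (_+ count (p ∘ (suc m ↑ʳ_)) (allFin n)) (count-allFin-suc m (p ∘ (_↑ˡ n))) ⟨
  count (p ∘ (_↑ˡ n)) (allFin (suc m)) + count (p ∘ (suc m ↑ʳ_)) (allFin n) ∎
  where
  open ≡-Reasoning
  bit = if p zero then 1 else 0

does-∈? : ∀ {n} (v : Fin n) (p : Subset n) → does (v ∈? p) ≡ lookup p v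
does-∈? zero    (inside  ∷ p) = refl
does-∈? zero    (outside ∷ p) = refl
does-∈? (suc v) (s ∷ p)       = does-∈? v p

deg-map : ∀ {A : Set} {n} (f : A → Subset n) L v → deg (map f L) v ≡ count (λ x → lookup (f x) v) L
deg-map f L v = begin
  length (filter (v ∈?_) (map f L))        ≡⟨ length-filter≡count (v ∈?_) (map f L) ⟩
  count (λ e → does (v ∈? e)) (map f L)    ≡⟨ count-map (λ e → does (v ∈? e)) f L ⟩
  count (λ x → does (v ∈? f x)) L          ≡⟨ count-cong (λ x → does-∈? v (f x)) L ⟩
  count (λ x → lookup (f x) v) L           ∎
  where open ≡-Reasoning

∣p++q∣≡∣p∣+∣q∣ : ∀ {m n} (p : Subset m) (q : Subset n) → ∣ p Vec.++ q ∣ ≡ ∣ p ∣ + ∣ q ∣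
∣p++q∣≡∣p∣+∣q∣ []            q = refl
∣p++q∣≡∣p∣+∣q∣ (inside  ∷ p) q = cong suc (∣p++q∣≡∣p∣+∣q∣ p q)
∣p++q∣≡∣p∣+∣q∣ (outside ∷ p) q = ∣p++q∣≡∣p∣+∣q∣ p q

count-≟ : ∀ {m} (i : Fin m) → count (λ j → does (j ≟ᶠ i)) (allFin m) ≡ 1
count-≟ {suc m} zero    = trans (count-allFin-suc m (λ j → does (j ≟ᶠ zero)))
  (cong suc (count-none (All.universal (λ _ → refl) (allFin m))))
count-≟ {suc m} (suc i) = trans (count-allFin-suc m (λ j → does (j ≟ᶠ suc i))) (count-≟ i)

module Doubling (m : ℕ) where

  inject : Fin m → Bool → Fin (m + m)
  inject j false = j ↑ˡ m
  inject j true  = m ↑ʳ j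

  index : Fin (m + m) → Fin m
  index v = [ id , id ]′ (splitAt m v)

  tag : Fin (m + m) → Bool
  tag v = [ const false , const true ]′ (splitAt m v)

  index-inject : ∀ j s → index (inject j s) ≡ j
  index-inject j false = cong [ id , id ]′ (splitAt-↑ˡ m j m)
  index-inject j true  = cong [ id , id ]′ (splitAt-↑ʳ m m j)

  tag-inject : ∀ j s → tag (inject j s) ≡ s
  tag-inject j false = cong [ const false , const true ]′ (splitAt-↑ˡ m j m)
  tag-inject j true  = cong [ const false , const true ]′ (splitAt-↑ʳ m m j)

  inject-index-tag : ∀ v → inject (index v) (tag v) ≡ v
  inject-index-tag v with splitAt m v in eq
  ... | inj₁ j = splitAt⁻¹-↑ˡ eq
  ... | inj₂ j = splitAt⁻¹-↑ʳ eq

open Doubling using (inject; index; tag; index-inject; tag-inject; inject-index-tag)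

xor≡true⇒≡not : ∀ a b → a xor b ≡ true → a ≡ not b
xor≡true⇒≡not true  false _ = refl
xor≡true⇒≡not false true  _ = refl

xor≡false⇒≡ : ∀ a b → a xor b ≡ false → a ≡ b
xor≡false⇒≡ true  true  _ = refl
xor≡false⇒≡ false false _ = refl

V : ℕ → Set
V = Vec Bool

_·_ : ∀ {n} → V n → V n → Bool
[]      · []      = false
(c ∷ i) · (a ∷ x) = (a ∧ c) xor (i · x)

_⊕_ : ∀ {n} → V n → V n → V n
[]      ⊕ []      = []
(a ∷ x) ⊕ (b ∷ y) = (a xor b) ∷ (x ⊕ y)

Nonzero : ∀ {n} → V n → Set
Nonzero = Any (_≡ true)

·-distribˡ-⊕ : ∀ {n} (i x y : V n) → i · (x ⊕ y) ≡ (i · x) xor (i · y)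
·-distribˡ-⊕ []      []      []      = refl
·-distribˡ-⊕ (c ∷ i) (a ∷ x) (b ∷ y) rewrite ∧-distribʳ-xor c a b | ·-distribˡ-⊕ i x y =
  xor-interchange (a ∧ c) (b ∧ c) (i · x) (i · y)

zeros-· : ∀ {n} (x : V n) → replicate n false · x ≡ false
zeros-· []      = refl
zeros-· (a ∷ x) rewrite ∧-zeroʳ a = zeros-· x

¬Nonzero-zeros : ∀ n → ¬ Nonzero (replicate n false)
¬Nonzero-zeros (suc n) (there p) = ¬Nonzero-zeros n p

allV : ∀ n → List (V n)
allV zero    = [] ∷ []
allV (suc n) = map (false ∷_) (allV n) ++ map (true ∷_) (allV n)

count-allV-suc : ∀ n (p : V (suc n) → Bool) →
  count p (allV (suc n)) ≡ count (p ∘ (false ∷_)) (allV n) + count (p ∘ (true ∷_)) (allV n)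
count-allV-suc n p = trans (count-++ p (map (false ∷_) (allV n)) _)
  (cong₂ _+_ (count-map p (false ∷_) (allV n)) (count-map p (true ∷_) (allV n)))

length-allV : ∀ n → length (allV n) ≡ 2 ^ n
length-allV zero    = refl
length-allV (suc n) = begin
  length (map (false ∷_) (allV n) ++ map (true ∷_) (allV n))
    ≡⟨ length-++ (map (false ∷_) (allV n)) ⟩
  length (map (false ∷_) (allV n)) + length (map (true ∷_) (allV n))
    ≡⟨ cong₂ _+_ (length-map (false ∷_) (allV n)) (length-map (true ∷_) (allV n)) ⟩
  length (allV n) + length (allV n)
    ≡⟨ cong (λ k → k + k) (length-allV n) ⟩
  2 ^ n + 2 ^ n
    ≡⟨ cong (2 ^ n +_) (+-identityʳ (2 ^ n)) ⟨
  2 ^ suc n ∎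
  where open ≡-Reasoning

count-affine : ∀ {n} (i : V n) s → Nonzero i → count (λ x → s xor (i · x)) (allV n) ≡ 2 ^ (n ∸ 1)
count-affine {suc n} (true ∷ i) s (here refl) = begin
  count (λ x → s xor ((true ∷ i) · x)) (allV (suc n))
    ≡⟨ count-allV-suc n _ ⟩
  count (λ x → s xor (i · x)) (allV n) + count (λ x → s xor not (i · x)) (allV n)
    ≡⟨ cong (count (λ x → s xor (i · x)) (allV n) +_) (count-cong (λ x → sym (not-distribʳ-xor s (i · x))) (allV n)) ⟩
  count (λ x → s xor (i · x)) (allV n) + count (λ x → not (s xor (i · x))) (allV n)
    ≡⟨ count+count-not≡length (λ x → s xor (i · x)) (allV n) ⟩
  length (allV n)
    ≡⟨ length-allV n ⟩
  2 ^ n ∎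
  where open ≡-Reasoning
count-affine {suc (suc n)} (c ∷ i) s (there i≢0) = begin
  count (λ x → s xor ((c ∷ i) · x)) (allV (suc (suc n)))
    ≡⟨ count-allV-suc (suc n) _ ⟩
  count (λ x → s xor (i · x)) (allV (suc n)) + count (λ x → s xor (c xor (i · x))) (allV (suc n))
    ≡⟨ cong (count (λ x → s xor (i · x)) (allV (suc n)) +_) (count-cong (λ x → sym (xor-assoc s c (i · x))) (allV (suc n))) ⟩
  count (λ x → s xor (i · x)) (allV (suc n)) + count (λ x → (s xor c) xor (i · x)) (allV (suc n))
    ≡⟨ cong₂ _+_ (count-affine i s i≢0) (count-affine i (s xor c) i≢0) ⟩
  2 ^ n + 2 ^ n
    ≡⟨ cong (2 ^ n +_) (+-identityʳ (2 ^ n)) ⟨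
  2 ^ suc n ∎
  where open ≡-Reasoning

_⊥_ : ∀ {n} → V n → V n → Set
i ⊥ w = i · w ≡ false

⊥-shift⇒≡ : ∀ {n} (i y x : V n) → i ⊥ (y ⊕ x) → i · y ≡ i · x
⊥-shift⇒≡ i y x i⊥ = xor≡false⇒≡ (i · y) (i · x) (trans (sym (·-distribˡ-⊕ i y x)) i⊥)

eliminate : ∀ {n} → V n → V (suc n) → V n
eliminate v (a ∷ w) = if a then w ⊕ v else w

·-eliminate : ∀ {n} (i v : V n) w → ((i · v) ∷ i) · w ≡ i · eliminate v w
·-eliminate i v (false ∷ w) = refl
·-eliminate i v (true  ∷ w) = trans (xor-comm (i · v) (i · w)) (sym (·-distribˡ-⊕ i w v))

headsFalse⊎pivot : ∀ {n} (N : List (V (suc n))) →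
  All (λ w → head w ≡ false) N ⊎ ∃₂ λ P Q → ∃ λ v → N ≡ P ++ (true ∷ v) ∷ Q
headsFalse⊎pivot []               = inj₁ []
headsFalse⊎pivot ((true ∷ v) ∷ N) = inj₂ ([] , N , v , refl)
headsFalse⊎pivot ((false ∷ w) ∷ N) with headsFalse⊎pivot N
... | inj₁ heads               = inj₁ (refl ∷ heads)
... | inj₂ (P , Q , v , refl) = inj₂ ((false ∷ w) ∷ P , Q , v , refl)

⊥-lift : ∀ {n} (i v : V n) P Q →
  All (i ⊥_) (map (eliminate v) (P ++ Q)) → All (((i · v) ∷ i) ⊥_) (P ++ (true ∷ v) ∷ Q)
⊥-lift i v P Q i⊥ with i⊥P , i⊥Q ← ++⁻ P (All.map (λ {w} → trans (·-eliminate i v w)) (map⁻ i⊥)) =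
  ++⁺ i⊥P (xor-same (i · v) ∷ i⊥Q)

-- The pivot (true ∷ v) is eliminated from the other rows; orthogonality to it then forces the
-- first coordinate of the solution to be i · v.
nonzero-⊥-short : ∀ n (N : List (V (suc n))) → length N ≤ n → ∃ λ i → Nonzero i × All (i ⊥_) N
nonzero-⊥-short zero [] _ = true ∷ [] , here refl , []
nonzero-⊥-short (suc n) N |N|≤ with headsFalse⊎pivot N
... | inj₁ heads = true ∷ replicate (suc n) false , here refl , All.map (λ {w} → e₁-⊥ {w}) heads
  where
  e₁-⊥ : ∀ {w} → head w ≡ false → (true ∷ replicate (suc n) false) ⊥ w
  e₁-⊥ {false ∷ w} refl = zeros-· w
... | inj₂ (P , Q , v , refl)
  with i , i≢0 , i⊥ ← nonzero-⊥-short n (map (eliminate v) (P ++ Q))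
         (subst (_≤ n) (sym (length-map (eliminate v) (P ++ Q)))
           (s≤s⁻¹ (subst (_≤ suc n) (length-++-sucʳ P (true ∷ v) Q) |N|≤)))
  = (i · v) ∷ i , there i≢0 , ⊥-lift i v P Q i⊥

R : ℕ → ℕ
R zero    = 0
R (suc t) = suc (R t + R t)

suc-R : ∀ t → suc (R t) ≡ 2 ^ t
suc-R zero    = refl
suc-R (suc t) = begin
  suc (suc (R t + R t))    ≡⟨ cong suc (+-suc (R t) (R t)) ⟨
  suc (R t) + suc (R t)    ≡⟨ cong (λ k → k + k) (suc-R t) ⟩
  2 ^ t + 2 ^ t            ≡⟨ cong (2 ^ t +_) (+-identityʳ (2 ^ t)) ⟨
  2 ^ suc t                ∎
  where open ≡-Reasoning

-- An enumeration of the 2^t − 1 nonzero vectors of length t: index zero is (1,0,…,0), and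
-- the pair (j , s) encoded in Fin (R t + R t) stands for s ∷ ι t j.
ι : ∀ t → Fin (R t) → V t
ι (suc t) zero    = true ∷ replicate t false
ι (suc t) (suc v) = tag (R t) v ∷ ι t (index (R t) v)

ι-nonzero : ∀ t j → Nonzero (ι t j)
ι-nonzero (suc t) zero    = here refl
ι-nonzero (suc t) (suc v) = there (ι-nonzero t (index (R t) v))

zeros⊎ι : ∀ t (i : V t) → i ≡ replicate t false ⊎ ∃ λ j → ι t j ≡ i
zeros⊎ι zero    []      = inj₁ refl
zeros⊎ι (suc t) (c ∷ i) with zeros⊎ι t i | c
... | inj₁ refl       | false = inj₁ refl
... | inj₁ refl       | true  = inj₂ (zero , refl)
... | inj₂ (j , refl) | c     =
  inj₂ (suc (inject (R t) j c) , cong₂ _∷_ (tag-inject (R t) j c) (cong (ι t) (index-inject (R t) j c)))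

ι-surjective : ∀ t (i : V t) → Nonzero i → ∃ λ j → ι t j ≡ i
ι-surjective t i i≢0 with zeros⊎ι t i
... | inj₁ refl = contradiction i≢0 (¬Nonzero-zeros t)
... | inj₂ ι⁻¹i = ι⁻¹i

module Construction (t : ℕ) where

  n : ℕ
  n = R t + R t

  vertex : Fin (R t) → Bool → Fin n
  vertex = inject (R t)

  part : Fin n → Fin (R t)
  part = index (R t)

  side : Fin n → Bool
  side = tag (R t)

  dots : V t → Vec Bool (R t)
  dots x = tabulate (λ j → ι t j · x)

  edge : V t → Subset n
  edge x = dots x Vec.++ ∁ (dots x)

  E : Edges n
  E = map edge (allV t)

  lookup-edge : ∀ x j s → lookup (edge x) (vertex j s) ≡ s xor (ι t j · x)
  lookup-edge x j false = trans (lookup-++ˡ (dots x) _ j) (lookup∘tabulate _ j)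
  lookup-edge x j true  = trans (lookup-++ʳ (dots x) _ j)
    (trans (lookup-map j not (dots x)) (cong not (lookup∘tabulate _ j)))

  ∈-edge⇒side : ∀ {x v} → v ∈ edge x → side v ≡ not (ι t (part v) · x)
  ∈-edge⇒side {x} {v} v∈ = xor≡true⇒≡not _ _ (begin
    side v xor (ι t (part v) · x)               ≡⟨ lookup-edge x (part v) (side v) ⟨
    lookup (edge x) (vertex (part v) (side v))  ≡⟨ cong (lookup (edge x)) (inject-index-tag (R t) v) ⟩
    lookup (edge x) v                           ≡⟨ []=⇒lookup v∈ ⟩
    true                                        ∎)
    where open ≡-Reasoning

  deg-edges : ∀ L j s → deg (map edge L) (vertex j s) ≡ count (λ x → s xor (ι t j · x)) L
  deg-edges L j s = trans (deg-map edge L (vertex j s)) (count-cong (λ x → lookup-edge x j s) L)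

  uniform : Uniform (R t) E
  uniform e e∈ with x , _ , refl ← ∈-map⁻ edge e∈ = begin
    ∣ dots x Vec.++ ∁ (dots x) ∣        ≡⟨ ∣p++q∣≡∣p∣+∣q∣ (dots x) (∁ (dots x)) ⟩
    ∣ dots x ∣ + ∣ ∁ (dots x) ∣         ≡⟨ cong (∣ dots x ∣ +_) (∣∁p∣≡n∸∣p∣ (dots x)) ⟩
    ∣ dots x ∣ + (R t ∸ ∣ dots x ∣)     ≡⟨ m+[n∸m]≡n (∣p∣≤n (dots x)) ⟩
    R t                                ∎
    where open ≡-Reasoning

  partite : Partite part E
  partite e e∈ u v u∈ v∈ same with x , _ , refl ← ∈-map⁻ edge e∈ = begin
    u                              ≡⟨ inject-index-tag (R t) u ⟨
    vertex (part u) (side u)       ≡⟨ cong₂ vertex same (trans (∈-edge⇒side u∈) (trans same′ (sym (∈-edge⇒side v∈)))) ⟩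
    vertex (part v) (side v)       ≡⟨ inject-index-tag (R t) v ⟩
    v                              ∎
    where
    open ≡-Reasoning
    same′ : not (ι t (part u) · x) ≡ not (ι t (part v) · x)
    same′ = cong (λ j → not (ι t j · x)) same

  parts-of-size-2 : PartsOfSize part 2
  parts-of-size-2 i = begin
    length (filter (λ v → part v ≟ᶠ i) (allFin n))
      ≡⟨ length-filter≡count (λ v → part v ≟ᶠ i) (allFin n) ⟩
    count (λ v → does (part v ≟ᶠ i)) (allFin n)
      ≡⟨ count-allFin-+ (R t) (R t) _ ⟩
    count (λ j → does (part (vertex j false) ≟ᶠ i)) (allFin (R t)) + count (λ j → does (part (vertex j true) ≟ᶠ i)) (allFin (R t))
      ≡⟨ cong₂ _+_ (count-cong (λ j → cong (λ k → does (k ≟ᶠ i)) (index-inject (R t) j false)) (allFin (R t)))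
                   (count-cong (λ j → cong (λ k → does (k ≟ᶠ i)) (index-inject (R t) j true)) (allFin (R t))) ⟩
    count (λ j → does (j ≟ᶠ i)) (allFin (R t)) + count (λ j → does (j ≟ᶠ i)) (allFin (R t))
      ≡⟨ cong (λ k → k + k) (count-≟ i) ⟩
    2 ∎
    where open ≡-Reasoning

  regular : Regular (2 ^ (t ∸ 1)) E
  regular v = begin
    deg E v                                                     ≡⟨ cong (deg E) (inject-index-tag (R t) v) ⟨
    deg E (vertex (part v) (side v))                            ≡⟨ deg-edges (allV t) (part v) (side v) ⟩
    count (λ x → side v xor (ι t (part v) · x)) (allV t)        ≡⟨ count-affine (ι t (part v)) (side v) (ι-nonzero t (part v)) ⟩
    2 ^ (t ∸ 1)                                                 ∎
    where open ≡-Reasoning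

module _ (k : ℕ) where
  open Construction (suc k)

  common-level : ∀ x₀ L → ∃ λ j → All (λ y → ι (suc k) j · y ≡ ι (suc k) j · x₀) (take k L)
  common-level x₀ L
    with i , i≢0 , i⊥ ← nonzero-⊥-short k (map (_⊕ x₀) (take k L)) (length-map-take-≤ (_⊕ x₀) k L)
    with j , refl ← ι-surjective (suc k) i i≢0
    = j , All.map (λ {y} → ⊥-shift⇒≡ (ι (suc k) j) y x₀) (map⁻ i⊥)

  no-shallow-hitting : ∀ L → Hitting (map edge L) → ¬ Shallow k (map edge L)
  no-shallow-hitting []        hit _ = contradiction (hit zero) λ ()
  no-shallow-hitting (x₀ ∷ L) hit shallow with common-level x₀ L | length L ≤? k
  ... | j , level | yes |L|≤k = contradiction (subst (1 ≤_) missed (hit (vertex j b))) λ ()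
    where
    b = ι (suc k) j · x₀
    level′ : All (λ y → ι (suc k) j · y ≡ b) (x₀ ∷ L)
    level′ = refl ∷ subst (All _) (take-all k L |L|≤k) level
    missed : deg (map edge (x₀ ∷ L)) (vertex j b) ≡ 0
    missed = trans (deg-edges (x₀ ∷ L) j b) (count-none (All.map (λ e → trans (cong (b xor_) e) (xor-same b)) level′))
  ... | j , level | no |L|≰k = 1+n≰n (≤-trans crowded (shallow (vertex j (not b))))
    where
    open Data.Nat.Properties.≤-Reasoning
    b = ι (suc k) j · x₀
    prefix = x₀ ∷ take k L
    crowded : suc k ≤ deg (map edge (x₀ ∷ L)) (vertex j (not b))
    crowded = begin
      suc k                                              ≡⟨ cong suc (m≤n⇒m⊓n≡m (<⇒≤ (≰⇒> |L|≰k))) ⟨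
      suc (k ⊓ length L)                                 ≡⟨ cong suc (length-take k L) ⟨
      length prefix                                      ≡⟨ count-all (All.map (λ e → trans (cong (not b xor_) e) (xor-inverseˡ b)) (refl ∷ level)) ⟨
      count (λ x → not b xor (ι (suc k) j · x)) prefix   ≤⟨ count-take-≤ _ (suc k) (x₀ ∷ L) ⟩
      count (λ x → not b xor (ι (suc k) j · x)) (x₀ ∷ L) ≡⟨ deg-edges (x₀ ∷ L) j (not b) ⟨
      deg (map edge (x₀ ∷ L)) (vertex j (not b))         ∎

  no-shallow-hitting-set : ¬ HasShallowHittingSet k E
  no-shallow-hitting-set (M , M⊆E , hit , shallow) with L , refl ← ⊆-map⇒≡map edge (allV (suc k)) M⊆E =
    no-shallow-hitting L hit shallow

theorem2p13 : (t r : ℕ) → 2 ≤ t → r ≡ 2 ^ t ∸ 1 →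
    Σ ℕ λ n → Σ (Edges n) λ E → Σ (Fin n → Fin r) λ part →
      Uniform r E × Partite part E × PartsOfSize part 2 ×
      Regular (2 ^ (t ∸ 1)) E × ¬ HasShallowHittingSet (t ∸ 1) E
theorem2p13 zero    r () _
theorem2p13 (suc k) r _  r≡ with refl ← trans r≡ (cong (_∸ 1) (sym (suc-R (suc k)))) =
  n , E , part , uniform , partite , parts-of-size-2 , regular , no-shallow-hitting-set k
  where open Construction (suc k)
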